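{- Let $N$ be an odd perfect number with $r = \omega(N)$ distinct prime factors. Then $$N^{2-r} \le \left(\frac{1}{3}\right)\left(\frac{2}{3}\right)^{r-1}.$$
   Context: $\sigma(n)$ denotes the sum of the positive divisors of $n$; $\omega(n)$ is the number of distinct prime divisors of $n$. An odd perfect number is an odd positive integer $N$ with $\sigma(N)=2N$. -}

module Defs where

open import Data.Nat as ℕ using (ℕ; zero; suc)
open import Data.Nat.Divisibility using (_∣_; _∣?_)
open import Data.Nat.Primality using (Prime; prime?)
open import Data.List using (List; filter; length; applyUpTo)
open import Data.Nat.ListAction using (sum)
open import Data.Integer using (ℤ; +_; -[1+_])
open import Data.Rational using (ℚ; 0ℚ; 1ℚ; _*_; 1/_; _≟_)
open import Data.Rational.Properties using ()
open import Relation.Nullary using (yes; no; ¬_)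
open import Relation.Nullary.Decidable using (_×-dec_)
open import Data.Product using (_×_)
open import Relation.Binary.PropositionalEquality using (_≡_)

oneTo : ℕ → List ℕ
oneTo n = applyUpTo suc n

σ : ℕ → ℕ
σ n = sum (filter (λ d → d ∣? n) (oneTo n))

ω : ℕ → ℕ
ω n = length (filter (λ p → prime? p ×-dec (p ∣? n)) (oneTo n))

OddPerfect : ℕ → Set
OddPerfect N = ¬ (2 ∣ N) × σ N ≡ 2 ℕ.* N

_^ℚ_ : ℚ → ℕ → ℚ
q ^ℚ zero = 1ℚ
q ^ℚ suc k = q * (q ^ℚ k)

-- integer powers of a rational; q^(-k) = 1/(q^k).
-- (Convention 0^(-k) = 0 is never used below, since N is odd hence nonzero.)
_^ᶻ_ : ℚ → ℤ → ℚ
q ^ᶻ (+ k) = q ^ℚ k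
q ^ᶻ -[1+ k ] with q ^ℚ suc k ≟ 0ℚ
... | yes _ = 0ℚ
... | no ne = 1/_ (q ^ℚ suc k) {{Data.Rational.≢-nonZero ne}}

{-# OPTIONS --safe #-}
-- Let p be prime, p ∤ M and m = p ^ a * M. The divisors of p m divisible by p are p times the
-- divisors of m, and those prime to p are exactly the divisors of M; hence
-- σ (p ^ (a + 1) M) = p σ (p ^ a M) + σ M, and so (p - 1) σ (p ^ a M) < p ^ (a + 1) σ M.
-- Thus no prime power is perfect, and neither is p ^ a q ^ b for distinct odd primes p, q, since
-- then p q ≤ 2 (p - 1) (q - 1). An odd perfect number N therefore has ω N ≥ 3, and N ≥ 9.
-- Writing ω N = 3 + k, the claim reads 1 ≤ N ^ (k + 1) (1/3) (2/3) ^ (k + 2): for k = 0 the right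
-- side is at least 9 (1/3) (2/3)² = 4/3, and increasing k multiplies it by (2/3) N ≥ 1.
module Submission where

open import Defs

module OddPerfectNumbers where

  open import Level using (0ℓ)
  open import Data.Nat
  open import Data.Nat.Properties
  open import Data.Nat.Divisibility
  open import Data.Nat.Primality using (Prime; prime?; prime⇒irreducible; prime⇒nonZero; prime⇒nonTrivial; ¬prime[1]; euclidsLemma)
  open import Data.Nat.Coprimality using (Coprime; coprime-divisor)
  import Data.Nat.Primality.Factorisation as Factorisation
  open import Data.Nat.Induction using (<-rec)
  open import Data.Nat.ListAction using (sum; product)
  open import Data.Nat.ListAction.Properties using (sum-++)
  open import Data.Nat.Tactic.RingSolver using (solve-∀)
  open import Data.List using ([]; _∷_; _++_; filter; length)
  open import Data.List.Properties using (applyUpTo-∷ʳ; filter-++; length-++)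
  open import Data.List.Relation.Unary.All using (All; _∷_)
  open import Data.Product using (_×_; _,_; ∃₂; ∃-syntax; proj₁; proj₂)
  open import Data.Sum using (inj₁; inj₂)
  open import Data.Empty using (⊥-elim)
  open import Function using (_∘_)
  open import Relation.Nullary using (Dec; yes; no; ¬_; ¬?)
  open import Relation.Nullary.Decidable using (_×-dec_)
  open import Relation.Unary using (Pred; Decidable)
  open import Relation.Binary.Definitions using (tri<; tri≈; tri>)
  open import Relation.Binary.PropositionalEquality

  -- Finite sums

  keepIf : {A : Set} → Dec A → ℕ → ℕ
  keepIf (yes _) x = x
  keepIf (no _)  _ = 0

  keepIf-yes : {A : Set} (D : Dec A) {x : ℕ} → A → keepIf D x ≡ x
  keepIf-yes (yes _) _ = refl
  keepIf-yes (no ¬a) a = ⊥-elim (¬a a)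

  keepIf-no : {A : Set} (D : Dec A) {x : ℕ} → ¬ A → keepIf D x ≡ 0
  keepIf-no (yes a) ¬a = ⊥-elim (¬a a)
  keepIf-no (no _)  _  = refl

  keepIf-+-¬? : {A : Set} (D : Dec A) (x : ℕ) → keepIf D x + keepIf (¬? D) x ≡ x
  keepIf-+-¬? (yes _) x = +-identityʳ x
  keepIf-+-¬? (no _)  x = refl

  sumTo : (ℕ → ℕ) → ℕ → ℕ
  sumTo f zero    = 0
  sumTo f (suc n) = sumTo f n + f (suc n)

  InRange : ℕ → ℕ → Set
  InRange n d = 1 ≤ d × d ≤ n

  sumTo-cong : ∀ {f g} n → (∀ d → InRange n d → f d ≡ g d) → sumTo f n ≡ sumTo g n
  sumTo-cong zero    f≗g = refl
  sumTo-cong (suc n) f≗g =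
    cong₂ _+_ (sumTo-cong n (λ d (1≤d , d≤n) → f≗g d (1≤d , m≤n⇒m≤1+n d≤n))) (f≗g (suc n) (s≤s z≤n , ≤-refl))

  sumTo-vanishing : ∀ {f} n → (∀ d → InRange n d → f d ≡ 0) → sumTo f n ≡ 0
  sumTo-vanishing n f≗0 = trans (sumTo-cong n f≗0) (sumTo-zero n)
    where
    sumTo-zero : ∀ n → sumTo (λ _ → 0) n ≡ 0
    sumTo-zero zero    = refl
    sumTo-zero (suc n) = trans (+-identityʳ _) (sumTo-zero n)

  sumTo-+ : ∀ f g n → sumTo (λ d → f d + g d) n ≡ sumTo f n + sumTo g n
  sumTo-+ f g zero    = refl
  sumTo-+ f g (suc n) rewrite sumTo-+ f g n = interchange (sumTo f n) (sumTo g n) (f (suc n)) (g (suc n))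
    where
    interchange : ∀ a b c e → a + b + (c + e) ≡ a + c + (b + e)
    interchange = solve-∀

  sumTo-*ˡ : ∀ c f n → sumTo (λ d → c * f d) n ≡ c * sumTo f n
  sumTo-*ˡ c f zero    = sym (*-zeroʳ c)
  sumTo-*ˡ c f (suc n) rewrite sumTo-*ˡ c f n = sym (*-distribˡ-+ c (sumTo f n) (f (suc n)))

  sumTo-+-range : ∀ f m k → sumTo f (m + k) ≡ sumTo f m + sumTo (λ i → f (m + i)) k
  sumTo-+-range f m zero    rewrite +-identityʳ m = sym (+-identityʳ _)
  sumTo-+-range f m (suc k) rewrite +-suc m k | sumTo-+-range f m k = +-assoc (sumTo f m) _ _

  sumTo-mono : ∀ f {m n} → m ≤ n → sumTo f m ≤ sumTo f n
  sumTo-mono f {m} m≤n with o , refl ← m≤n⇒∃[o]m+o≡n m≤n =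
    subst (sumTo f m ≤_) (sym (sumTo-+-range f m o)) (m≤m+n _ _)

  sumTo-beyond : ∀ f {m n} → (∀ d → m < d → f d ≡ 0) → m ≤ n → sumTo f n ≡ sumTo f m
  sumTo-beyond f {m} f≗0 m≤n with o , refl ← m≤n⇒∃[o]m+o≡n m≤n = begin
    sumTo f (m + o)                               ≡⟨ sumTo-+-range f m o ⟩
    sumTo f m + sumTo (λ i → f (m + i)) o         ≡⟨ cong (sumTo f m +_) tail≡0 ⟩
    sumTo f m + 0                                 ≡⟨ +-identityʳ _ ⟩
    sumTo f m                                     ∎
    where
    open ≡-Reasoning
    tail≡0 : sumTo (λ i → f (m + i)) o ≡ 0
    tail≡0 = sumTo-vanishing o (λ i (1≤i , _) → f≗0 (m + i) (m<m+n m 1≤i))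

  sumTo-multiples : ∀ p .{{_ : NonZero p}} (h : ℕ → ℕ) M →
    sumTo (λ d → keepIf (p ∣? d) (h d)) (p * M) ≡ sumTo (λ e → h (p * e)) M
  sumTo-multiples p h zero rewrite *-zeroʳ p = refl
  sumTo-multiples p@(suc p′) h (suc M) = begin
    sumTo f (p * suc M)                                       ≡⟨ cong (sumTo f) p[1+M]≡pM+p ⟩
    sumTo f (p * M + p)                                       ≡⟨ sumTo-+-range f (p * M) p ⟩
    sumTo f (p * M) + (sumTo (λ i → f (p * M + i)) p′ + f (p * M + p))
      ≡⟨ cong₂ (λ a b → a + (b + f (p * M + p))) (sumTo-multiples p h M) gap≡0 ⟩
    S + f (p * M + p)                                         ≡⟨ cong (S +_) (keepIf-yes (p ∣? _) p∣pM+p) ⟩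
    S + h (p * M + p)                                         ≡⟨ cong (λ x → S + h x) (sym p[1+M]≡pM+p) ⟩
    sumTo (λ e → h (p * e)) (suc M)                           ∎
    where
    open ≡-Reasoning
    f : ℕ → ℕ
    f d = keepIf (p ∣? d) (h d)
    S : ℕ
    S = sumTo (λ e → h (p * e)) M
    p[1+M]≡pM+p : p * suc M ≡ p * M + p
    p[1+M]≡pM+p = trans (*-suc p M) (+-comm p (p * M))
    p∣pM+p : p ∣ p * M + p
    p∣pM+p = ∣m∣n⇒∣m+n (m∣m*n M) ∣-refl
    gap≡0 : sumTo (λ i → f (p * M + i)) p′ ≡ 0
    gap≡0 = sumTo-vanishing p′ λ i (1≤i , i≤p′) → keepIf-no (p ∣? _) λ p∣pM+i →
      <⇒≱ (s≤s i≤p′) (∣⇒≤ {{>-nonZero 1≤i}} (∣m+n∣m⇒∣n p∣pM+i (m∣m*n M)))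

  module _ {P : Pred ℕ 0ℓ} (P? : Decidable P) where

    filter-oneTo-suc : ∀ n → filter P? (oneTo (suc n)) ≡ filter P? (oneTo n) ++ filter P? (suc n ∷ [])
    filter-oneTo-suc n = trans (cong (filter P?) (sym (applyUpTo-∷ʳ suc n))) (filter-++ P? (oneTo n) _)

    sum-filter-oneTo : ∀ n → sum (filter P? (oneTo n)) ≡ sumTo (λ d → keepIf (P? d) d) n
    sum-filter-oneTo zero    = refl
    sum-filter-oneTo (suc n) rewrite filter-oneTo-suc n | sum-++ (filter P? (oneTo n)) (filter P? (suc n ∷ []))
      = cong₂ _+_ (sum-filter-oneTo n) last
      where
      last : sum (filter P? (suc n ∷ [])) ≡ keepIf (P? (suc n)) (suc n)
      last with P? (suc n)
      ... | yes _ = +-identityʳ (suc n)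
      ... | no _  = refl

    length-filter-oneTo : ∀ n → length (filter P? (oneTo n)) ≡ sumTo (λ d → keepIf (P? d) 1) n
    length-filter-oneTo zero    = refl
    length-filter-oneTo (suc n) rewrite filter-oneTo-suc n | length-++ (filter P? (oneTo n)) {filter P? (suc n ∷ [])}
      = cong₂ _+_ (length-filter-oneTo n) last
      where
      last : length (filter P? (suc n ∷ [])) ≡ keepIf (P? (suc n)) 1
      last with P? (suc n)
      ... | yes _ = refl
      ... | no _  = refl

  -- The divisor sum at a prime power

  σ-sumTo : ∀ n → σ n ≡ sumTo (λ d → keepIf (d ∣? n) d) n
  σ-sumTo n = sum-filter-oneTo (_∣? n) n

  σ-∤ : ℕ → ℕ → ℕ
  σ-∤ p n = sumTo (λ d → keepIf (¬? (p ∣? d)) (keepIf (d ∣? n) d)) n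

  σ-* : ∀ p .{{_ : NonZero p}} M → σ (p * M) ≡ p * σ M + σ-∤ p (p * M)
  σ-* p M = begin
    σ (p * M)                                                   ≡⟨ σ-sumTo (p * M) ⟩
    sumTo (λ d → keepIf (d ∣? p * M) d) (p * M)                 ≡⟨ sumTo-cong (p * M) (λ d _ → sym (keepIf-+-¬? (p ∣? d) _)) ⟩
    sumTo (λ d → keepIf (p ∣? d) (keepIf (d ∣? p * M) d) + _) (p * M)
                                                                ≡⟨ sumTo-+ _ _ (p * M) ⟩
    sumTo (λ d → keepIf (p ∣? d) (keepIf (d ∣? p * M) d)) (p * M) + σ-∤ p (p * M)
                                                                ≡⟨ cong (_+ σ-∤ p (p * M)) multiples ⟩
    p * σ M + σ-∤ p (p * M)                                     ∎
    where
    open ≡-Reasoning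
    pe∣pM : ∀ e → keepIf (p * e ∣? p * M) (p * e) ≡ p * keepIf (e ∣? M) e
    pe∣pM e with e ∣? M
    ... | yes e∣M = keepIf-yes (p * e ∣? p * M) (*-monoʳ-∣ p e∣M)
    ... | no e∤M  = trans (keepIf-no (p * e ∣? p * M) (e∤M ∘ *-cancelˡ-∣ p)) (sym (*-zeroʳ p))
    multiples : sumTo (λ d → keepIf (p ∣? d) (keepIf (d ∣? p * M) d)) (p * M) ≡ p * σ M
    multiples = begin
      _                                          ≡⟨ sumTo-multiples p (λ d → keepIf (d ∣? p * M) d) M ⟩
      sumTo (λ e → keepIf (p * e ∣? p * M) (p * e)) M ≡⟨ sumTo-cong M (λ e _ → pe∣pM e) ⟩
      sumTo (λ e → p * keepIf (e ∣? M) e) M      ≡⟨ sumTo-*ˡ p _ M ⟩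
      p * sumTo (λ e → keepIf (e ∣? M) e) M      ≡⟨ cong (p *_) (sym (σ-sumTo M)) ⟩
      p * σ M                                    ∎

  prime∤⇒coprime : ∀ {p d} → Prime p → ¬ p ∣ d → Coprime d p
  prime∤⇒coprime pr p∤d (i∣d , i∣p) with prime⇒irreducible pr i∣p
  ... | inj₁ i≡1    = i≡1
  ... | inj₂ refl   = ⊥-elim (p∤d i∣d)

  -- A divisor of p·M prime to p divides M; the divisors of p·M beyond M contribute nothing.
  σ-∤-*-prime : ∀ {p} M → Prime p → 0 < M → σ-∤ p (p * M) ≡ σ-∤ p M
  σ-∤-*-prime {p} M pr 0<M =
    trans (sumTo-cong (p * M) same-terms) (sumTo-beyond _ vanish (m≤n*m M p {{prime⇒nonZero pr}}))
    where
    same-terms : ∀ d → InRange (p * M) d →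
      keepIf (¬? (p ∣? d)) (keepIf (d ∣? p * M) d) ≡ keepIf (¬? (p ∣? d)) (keepIf (d ∣? M) d)
    same-terms d _ with p ∣? d
    ... | yes _  = refl
    ... | no p∤d with d ∣? p * M | d ∣? M
    ...   | yes _     | yes _   = refl
    ...   | no _      | no _    = refl
    ...   | yes d∣pM  | no d∤M  = ⊥-elim (d∤M (coprime-divisor (prime∤⇒coprime pr p∤d) d∣pM))
    ...   | no d∤pM   | yes d∣M = ⊥-elim (d∤pM (∣-trans d∣M (n∣m*n p)))
    vanish : ∀ d → M < d → keepIf (¬? (p ∣? d)) (keepIf (d ∣? M) d) ≡ 0
    vanish d M<d with d ∣? M
    ... | yes d∣M = ⊥-elim (<⇒≱ M<d (∣⇒≤ {{>-nonZero 0<M}} d∣M))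
    ... | no _ with ¬? (p ∣? d)
    ...   | yes _ = refl
    ...   | no _  = refl

  σ-∤≡σ : ∀ {p} M → ¬ p ∣ M → σ-∤ p M ≡ σ M
  σ-∤≡σ {p} M p∤M = trans (sumTo-cong M same-terms) (sym (σ-sumTo M))
    where
    same-terms : ∀ d → InRange M d → keepIf (¬? (p ∣? d)) (keepIf (d ∣? M) d) ≡ keepIf (d ∣? M) d
    same-terms d _ with d ∣? M
    ... | yes d∣M = keepIf-yes (¬? (p ∣? d)) (λ p∣d → p∤M (∣-trans p∣d d∣M))
    ... | no _ with ¬? (p ∣? d)
    ...   | yes _ = refl
    ...   | no _  = refl

  σ-∤-^ : ∀ {p} M a → Prime p → 0 < M → ¬ p ∣ M → σ-∤ p (p ^ a * M) ≡ σ M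
  σ-∤-^ M zero    pr 0<M p∤M rewrite *-identityˡ M = σ-∤≡σ M p∤M
  σ-∤-^ {p} M (suc a) pr 0<M p∤M = begin
    σ-∤ p (p ^ suc a * M)   ≡⟨ cong (σ-∤ p) (*-assoc p (p ^ a) M) ⟩
    σ-∤ p (p * (p ^ a * M)) ≡⟨ σ-∤-*-prime (p ^ a * M) pr (*-mono-≤ (m^n>0 p a) 0<M) ⟩
    σ-∤ p (p ^ a * M)       ≡⟨ σ-∤-^ M a pr 0<M p∤M ⟩
    σ M                     ∎
    where
    open ≡-Reasoning
    instance _ = prime⇒nonZero pr

  σ-^-suc : ∀ {p} M a → Prime p → 0 < M → ¬ p ∣ M → σ (p ^ suc a * M) ≡ p * σ (p ^ a * M) + σ M
  σ-^-suc {p} M a pr 0<M p∤M = begin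
    σ (p ^ suc a * M)                             ≡⟨ cong σ (*-assoc p (p ^ a) M) ⟩
    σ (p * (p ^ a * M))                           ≡⟨ σ-* p (p ^ a * M) ⟩
    p * σ (p ^ a * M) + σ-∤ p (p * (p ^ a * M))   ≡⟨ cong (λ n → p * σ (p ^ a * M) + σ-∤ p n) (sym (*-assoc p (p ^ a) M)) ⟩
    p * σ (p ^ a * M) + σ-∤ p (p ^ suc a * M)     ≡⟨ cong (p * σ (p ^ a * M) +_) (σ-∤-^ M (suc a) pr 0<M p∤M) ⟩
    p * σ (p ^ a * M) + σ M                       ∎
    where
    open ≡-Reasoning
    instance _ = prime⇒nonZero pr

  -- σ (p ^ a * M) = (1 + p + ⋯ + p ^ a) σ M, multiplied out by p - 1 without subtraction.
  σ-geometric : ∀ {p} M a → Prime p → 0 < M → ¬ p ∣ M →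
    p * σ (p ^ a * M) + σ M ≡ σ (p ^ a * M) + p ^ suc a * σ M
  σ-geometric {p} M zero pr 0<M p∤M rewrite *-identityˡ M = identity p (σ M)
    where
    identity : ∀ p s → p * s + s ≡ s + p * 1 * s
    identity = solve-∀
  σ-geometric {p} M (suc a) pr 0<M p∤M
    rewrite σ-^-suc M a pr 0<M p∤M = step p (σ (p ^ a * M)) (σ M) (p ^ suc a) (σ-geometric M a pr 0<M p∤M)
    where
    step : ∀ p s x P → p * s + x ≡ s + P * x → p * (p * s + x) + x ≡ p * s + x + p * P * x
    step p s x P eq = trans (cong (λ y → p * y + x) eq) (expand p s x P)
      where
      expand : ∀ p s x P → p * (s + P * x) + x ≡ p * s + x + p * P * x
      expand = solve-∀

  σ-positive : ∀ M → 0 < M → 0 < σ M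
  σ-positive M@(suc m) 0<M rewrite σ-sumTo M =
    <-≤-trans 0<M (≤-trans (≤-reflexive (sym (keepIf-yes (M ∣? M) ∣-refl))) (m≤n+m _ (sumTo _ m)))

  abundancy-bound : ∀ {p} M a → Prime p → 0 < M → ¬ p ∣ M → (p ∸ 1) * σ (p ^ a * M) < p ^ suc a * σ M
  abundancy-bound {suc p′} M a pr 0<M p∤M = +-cancelˡ-< s _ _ (begin-strict
    s + p′ * s               <⟨ +-monoʳ-< s (m<m+n (p′ * s) (σ-positive M 0<M)) ⟩
    s + (p′ * s + σ M)       ≡⟨ sym (+-assoc s (p′ * s) (σ M)) ⟩
    suc p′ * s + σ M         ≡⟨ σ-geometric M a pr 0<M p∤M ⟩
    s + suc p′ ^ suc a * σ M ∎)
    where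
    open ≤-Reasoning
    s = σ (suc p′ ^ a * M)
  abundancy-bound {zero} M a ()

  -- Counting prime divisors

  module _ {P : Pred ℕ 0ℓ} (P? : Decidable P) where

    indicator : ℕ → ℕ
    indicator d = keepIf (P? d) 1

    count : ℕ → ℕ
    count = sumTo indicator

    count-step : ∀ {m k} → m < k → P k → suc (count m) ≤ count k
    count-step {m} {suc k} (s≤s m≤k) Pk rewrite keepIf-yes (P? (suc k)) {1} Pk =
      subst (_≤ count k + 1) (+-comm (count m) 1) (+-monoˡ-≤ 1 (sumTo-mono indicator m≤k))

    3≤count-increasing : ∀ {x y z m} → 0 < x → x < y → y < z → z ≤ m → P x → P y → P z → 3 ≤ count m
    3≤count-increasing 0<x x<y y<z z≤m Px Py Pz =
      ≤-trans (s≤s (s≤s (count-step 0<x Px))) (≤-trans (s≤s (count-step x<y Py))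
        (≤-trans (count-step y<z Pz) (sumTo-mono indicator z≤m)))

    module _ {n} (inRange : ∀ {d} → P d → InRange n d) where

      private
        lower : ∀ {d} → P d → 0 < d
        lower Pd = proj₁ (inRange Pd)
        upper : ∀ {d} → P d → d ≤ n
        upper Pd = proj₂ (inRange Pd)

      3≤count-insert : ∀ {x y z} → x < y → z ≢ x → z ≢ y → P x → P y → P z → 3 ≤ count n
      3≤count-insert {x} {y} {z} x<y z≢x z≢y Px Py Pz with <-cmp z x | <-cmp z y
      ... | tri< z<x _ _ | _            = 3≤count-increasing (lower Pz) z<x x<y (upper Py) Pz Px Py
      ... | tri> _ _ x<z | tri< z<y _ _ = 3≤count-increasing (lower Px) x<z z<y (upper Py) Px Pz Py
      ... | tri> _ _ _   | tri> _ _ y<z = 3≤count-increasing (lower Px) x<y y<z (upper Pz) Px Py Pz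
      ... | tri≈ _ z≡x _ | _            = ⊥-elim (z≢x z≡x)
      ... | tri> _ _ _   | tri≈ _ z≡y _ = ⊥-elim (z≢y z≡y)

      3≤count : ∀ {x y z} → x ≢ y → z ≢ x → z ≢ y → P x → P y → P z → 3 ≤ count n
      3≤count {x} {y} x≢y z≢x z≢y Px Py Pz with <-cmp x y
      ... | tri< x<y _ _ = 3≤count-insert x<y z≢x z≢y Px Py Pz
      ... | tri≈ _ x≡y _ = ⊥-elim (x≢y x≡y)
      ... | tri> _ _ y<x = 3≤count-insert y<x z≢y z≢x Py Px Pz

  PrimeDivisor : ℕ → Pred ℕ 0ℓ
  PrimeDivisor N p = Prime p × p ∣ N

  ω-count : ∀ N → ω N ≡ count (λ p → prime? p ×-dec p ∣? N) N
  ω-count N = length-filter-oneTo (λ p → prime? p ×-dec p ∣? N) N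

  3≤ω : ∀ {N p q s} → 0 < N → p ≢ q → s ≢ p → s ≢ q →
    PrimeDivisor N p → PrimeDivisor N q → PrimeDivisor N s → 3 ≤ ω N
  3≤ω {N} 0<N p≢q s≢p s≢q Pp Pq Ps = subst (3 ≤_) (sym (ω-count N))
    (3≤count (λ p → prime? p ×-dec p ∣? N) inRange p≢q s≢p s≢q Pp Pq Ps)
    where
    inRange : ∀ {d} → PrimeDivisor N d → InRange N d
    inRange (pr , d∣N) = >-nonZero⁻¹ _ {{prime⇒nonZero pr}} , ∣⇒≤ {{>-nonZero 0<N}} d∣N

  prime-divisor : ∀ {n} → 1 < n → ∃[ p ] PrimeDivisor n p
  prime-divisor {1} (s≤s ())
  prime-divisor {n@(suc (suc _))} _ = first-factor (factors f) (isFactorisation f) (factorsPrime f)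
    where
    open Factorisation using (factorise; factors; PrimeFactorisation)
    open PrimeFactorisation using (isFactorisation; factorsPrime)
    f = factorise n
    first-factor : ∀ ps → n ≡ product ps → All Prime ps → ∃[ p ] PrimeDivisor n p
    first-factor []       ()
    first-factor (p ∷ ps) n≡p*ps (pr ∷ _) = p , pr , divides (product ps) (trans n≡p*ps (*-comm p (product ps)))

  factor-out : ∀ {p} → 1 < p → ∀ n → 0 < n → ∃₂ λ a m → 0 < m × ¬ p ∣ m × n ≡ p ^ a * m
  factor-out {p} 1<p = <-rec _ go
    where
    go : ∀ n → (∀ {k} → k < n → 0 < k → ∃₂ λ a m → 0 < m × ¬ p ∣ m × k ≡ p ^ a * m) →
         0 < n → ∃₂ λ a m → 0 < m × ¬ p ∣ m × n ≡ p ^ a * m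
    go n rec 0<n with p ∣? n
    ... | no p∤n = 0 , n , 0<n , p∤n , sym (*-identityˡ n)
    ... | yes (divides zero refl) = ⊥-elim (<-irrefl refl 0<n)
    ... | yes (divides q@(suc _) refl) with a , m , 0<m , p∤m , q≡pᵃm ← rec (m<m*n q p 1<p) z<s =
      suc a , m , 0<m , p∤m , trans (cong (_* p) q≡pᵃm) (reassociate (p ^ a) m p)
      where
      reassociate : ∀ x m p → x * m * p ≡ p * x * m
      reassociate = solve-∀

  -- Odd perfect numbers

  Perfect : ℕ → Set
  Perfect n = σ n ≡ 2 * n

  prime⇒2≤ : ∀ {p} → Prime p → 2 ≤ p
  prime⇒2≤ {p} pr = nonTrivial⇒n>1 p {{prime⇒nonTrivial pr}}

  prime∤1 : ∀ {p} → Prime p → ¬ p ∣ 1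
  prime∤1 pr p∣1 = ¬prime[1] (subst Prime (∣1⇒≡1 p∣1) pr)

  prime∤prime^ : ∀ {p q} b → Prime p → Prime q → p ≢ q → ¬ p ∣ q ^ b
  prime∤prime^ zero    pr _  _   = prime∤1 pr
  prime∤prime^ (suc b) pr qr p≢q p∣qqᵇ with euclidsLemma _ _ pr p∣qqᵇ
  ... | inj₂ p∣qᵇ = prime∤prime^ b pr qr p≢q p∣qᵇ
  ... | inj₁ p∣q with prime⇒irreducible qr p∣q
  ...   | inj₁ p≡1 = ¬prime[1] (subst Prime p≡1 pr)
  ...   | inj₂ p≡q = p≢q p≡q

  prime-power-not-perfect : ∀ {p} a → Prime p → ¬ Perfect (p ^ a)
  prime-power-not-perfect {p@(suc (suc t))} a pr σpᵃ≡2pᵃ = <⇒≱ bound (begin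
    p * P * 1                ≡⟨ *-identityʳ (p * P) ⟩
    p * P                    ≤⟨ *-monoˡ-≤ P (m≤m+n p t) ⟩
    (p + t) * P              ≡⟨ regroup t P ⟩
    (p ∸ 1) * (2 * P)        ∎)
    where
    open ≤-Reasoning
    P = p ^ a
    regroup : ∀ t P → (2 + t + t) * P ≡ (1 + t) * (2 * P)
    regroup = solve-∀
    bound : (p ∸ 1) * (2 * P) < p * P * 1
    bound = subst (λ s → (p ∸ 1) * s < p * P * 1) (trans (cong σ (*-identityʳ P)) σpᵃ≡2pᵃ)
      (abundancy-bound 1 a pr z<s (prime∤1 pr))

  -- p q ≤ 2 (p - 1) (q - 1) for distinct odd primes p = 3 + t and q = 3 + u.
  odd-primes-product-bound : ∀ t u → t ≢ u → (3 + t) * (3 + u) ≤ 2 * (2 + t) * (2 + u)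
  odd-primes-product-bound zero    zero    t≢u = ⊥-elim (t≢u refl)
  odd-primes-product-bound zero    (suc u) _   = ≤-trans (m≤m+n _ u) (≤-reflexive (expand u))
    where
    expand : ∀ u → 3 * (4 + u) + u ≡ 2 * 2 * (3 + u)
    expand = solve-∀
  odd-primes-product-bound (suc t) u       _   = ≤-trans (m≤m+n _ (2 * u + t + t * u)) (≤-reflexive (expand t u))
    where
    expand : ∀ t u → (4 + t) * (3 + u) + (2 * u + t + t * u) ≡ 2 * (3 + t) * (2 + u)
    expand = solve-∀

  two-odd-prime-powers-not-perfect : ∀ {p q} a b → Prime p → Prime q → 3 ≤ p → 3 ≤ q → p ≢ q →
    ¬ Perfect (p ^ a * q ^ b)
  two-odd-prime-powers-not-perfect {p@(suc (2+ t))} {q@(suc (2+ u))} a b pr qr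
    (s≤s (s≤s (s≤s _))) (s≤s (s≤s (s≤s _))) p≢q σ≡2PQ =
    <⇒≱ (*-cancelʳ-< (P * Q) _ _ (begin-strict
      2 * (2 + t) * (2 + u) * (P * Q)      ≡⟨ regroupˡ t u P Q ⟩
      (2 + u) * ((2 + t) * (2 * (P * Q)))  <⟨ *-monoʳ-< (2 + u) boundₚ ⟩
      (2 + u) * (p * P * σ Q)              ≡⟨ regroupᵐ (2 + u) (p * P) (σ Q) ⟩
      p * P * ((2 + u) * σ Q)              <⟨ *-monoʳ-< (p * P) {{m*n≢0 p P}} boundq ⟩
      p * P * (q * Q * 1)                  ≡⟨ regroupʳ t u P Q ⟩
      (3 + t) * (3 + u) * (P * Q)          ∎))
      (odd-primes-product-bound t u (λ t≡u → p≢q (cong (3 +_) t≡u)))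
    where
    open ≤-Reasoning
    P = p ^ a
    Q = q ^ b
    instance _ = m^n≢0 p a
    regroupˡ : ∀ t u P Q → 2 * (2 + t) * (2 + u) * (P * Q) ≡ (2 + u) * ((2 + t) * (2 * (P * Q)))
    regroupˡ = solve-∀
    regroupᵐ : ∀ x y z → x * (y * z) ≡ y * (x * z)
    regroupᵐ = solve-∀
    regroupʳ : ∀ t u P Q → (3 + t) * P * ((3 + u) * Q * 1) ≡ (3 + t) * (3 + u) * (P * Q)
    regroupʳ = solve-∀
    boundₚ : (2 + t) * (2 * (P * Q)) < p * P * σ Q
    boundₚ = subst (λ s → (2 + t) * s < p * P * σ Q) σ≡2PQ
      (abundancy-bound Q a pr (m^n>0 q b) (prime∤prime^ b pr qr p≢q))
    boundq : (2 + u) * σ Q < q * Q * 1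
    boundq = subst (λ n → (2 + u) * σ n < q * Q * 1) (*-identityʳ Q) (abundancy-bound 1 b qr z<s (prime∤1 qr))

  oddPerfect⇒9≤ : ∀ {N} → OddPerfect N → 9 ≤ N
  oddPerfect⇒9≤ {0} (odd , _) = ⊥-elim (odd (divides 0 refl))
  oddPerfect⇒9≤ {1} (_ , ())
  oddPerfect⇒9≤ {2} (odd , _) = ⊥-elim (odd (divides 1 refl))
  oddPerfect⇒9≤ {3} (_ , ())
  oddPerfect⇒9≤ {4} (odd , _) = ⊥-elim (odd (divides 2 refl))
  oddPerfect⇒9≤ {5} (_ , ())
  oddPerfect⇒9≤ {6} (odd , _) = ⊥-elim (odd (divides 3 refl))
  oddPerfect⇒9≤ {7} (_ , ())
  oddPerfect⇒9≤ {8} (odd , _) = ⊥-elim (odd (divides 4 refl))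
  oddPerfect⇒9≤ {suc (suc (suc (suc (suc (suc (suc (suc (suc _))))))))} _ = s≤s (s≤s (s≤s (s≤s (s≤s (s≤s (s≤s (s≤s (s≤s z≤n))))))))

  oddPerfect⇒0< : ∀ {N} → OddPerfect N → 0 < N
  oddPerfect⇒0< op = ≤-trans (s≤s z≤n) (oddPerfect⇒9≤ op)

  oddPerfect⇒1< : ∀ {N} → OddPerfect N → 1 < N
  oddPerfect⇒1< op = ≤-trans (s≤s (s≤s z≤n)) (oddPerfect⇒9≤ op)

  odd⇒3≤prime-divisor : ∀ {N p} → ¬ 2 ∣ N → PrimeDivisor N p → 3 ≤ p
  odd⇒3≤prime-divisor {p = p} odd (pr , p∣N) with prime⇒2≤ pr
  ... | s≤s (s≤s {n = p∸2} _) with p∸2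
  ...   | zero  = ⊥-elim (odd p∣N)
  ...   | suc _ = s≤s (s≤s (s≤s z≤n))

  ∣∧∤⇒≢ : ∀ {p q m} → q ∣ m → ¬ p ∣ m → p ≢ q
  ∣∧∤⇒≢ q∣m p∤m refl = p∤m q∣m

  perfect⇒cofactor>1 : ∀ {p} a {M} → Prime p → 0 < M → Perfect (p ^ a * M) → 1 < M
  perfect⇒cofactor>1 {p} a pr 0<M perfect = ≤∧≢⇒< 0<M λ { refl →
    prime-power-not-perfect a pr (subst Perfect (*-identityʳ (p ^ a)) perfect) }

  perfect⇒cofactor>1′ : ∀ {p q} a b {K} → Prime p → Prime q → 3 ≤ p → 3 ≤ q → p ≢ q → 0 < K →
    Perfect (p ^ a * (q ^ b * K)) → 1 < K
  perfect⇒cofactor>1′ {p} {q} a b pr qr 3≤p 3≤q p≢q 0<K perfect = ≤∧≢⇒< 0<K λ { refl →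
    two-odd-prime-powers-not-perfect a b pr qr 3≤p 3≤q p≢q
      (subst Perfect (cong (p ^ a *_) (*-identityʳ (q ^ b))) perfect) }

  oddPerfect⇒3≤ω : ∀ {N} → OddPerfect N → 3 ≤ ω N
  oddPerfect⇒3≤ω {N} op@(odd , perfect)
    with p , p-div ← prime-divisor (oddPerfect⇒1< op)
    with a , M , 0<M , p∤M , refl ← factor-out (prime⇒2≤ (proj₁ p-div)) N (oddPerfect⇒0< op)
    with q , qr , q∣M ← prime-divisor (perfect⇒cofactor>1 a (proj₁ p-div) 0<M perfect)
    with b , K , 0<K , q∤K , refl ← factor-out (prime⇒2≤ qr) M 0<M
    with s , sr , s∣K ← prime-divisor (perfect⇒cofactor>1′ a b (proj₁ p-div) qr
           (odd⇒3≤prime-divisor odd p-div) (odd⇒3≤prime-divisor odd (qr , ∣-trans q∣M (n∣m*n (p ^ a))))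
           (∣∧∤⇒≢ q∣M p∤M) 0<K perfect)
    = 3≤ω (oddPerfect⇒0< op) (∣∧∤⇒≢ q∣M p∤M) (≢-sym (∣∧∤⇒≢ s∣M p∤M)) (≢-sym (∣∧∤⇒≢ s∣K q∤K))
        p-div (qr , ∣-trans q∣M M∣N) (sr , ∣-trans s∣M M∣N)
    where
    M∣N = n∣m*n (p ^ a)
    s∣M = ∣-trans s∣K (n∣m*n (q ^ b))

module RationalPowers where

  open import Data.Nat as ℕ using (zero; suc)
  open import Data.Nat.Coprimality as Coprime using (1-coprimeTo)
  open import Data.Integer as ℤ using (+_; -[1+_]; _-_)
  import Data.Integer.Properties as ℤ
  open import Data.Rational hiding (_-_)
  open import Data.Rational.Properties
  open import Data.Rational.Solver using (module +-*-Solver)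
  open import Relation.Nullary using (yes; no)
  open import Relation.Nullary.Decidable using (toWitness)
  open import Relation.Binary.PropositionalEquality using (_≡_; refl; sym; cong; subst)
  open import Data.Empty using (⊥-elim)

  /1-mono-≤ : ∀ {m n} → m ℕ.≤ n → + m / 1 ≤ + n / 1
  /1-mono-≤ {m} {n} m≤n rewrite normalize-coprime (Coprime.sym (1-coprimeTo m))
    | normalize-coprime (Coprime.sym (1-coprimeTo n)) =
    *≤* (ℤ.*-monoʳ-≤-nonNeg (+ 1) (ℤ.+≤+ m≤n))

  1≤⇒nonNegative : ∀ {x} → 1ℚ ≤ x → NonNegative x
  1≤⇒nonNegative 1≤x = nonNegative (≤-trans (toWitness {a? = 0ℚ ≤? 1ℚ} _) 1≤x)

  1≤⇒positive : ∀ {x} → 1ℚ ≤ x → Positive x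
  1≤⇒positive 1≤x = positive (<-≤-trans (toWitness {a? = 0ℚ <? 1ℚ} _) 1≤x)

  1≤-*-closed : ∀ {x y} → 1ℚ ≤ x → 1ℚ ≤ y → 1ℚ ≤ x * y
  1≤-*-closed {x} {y} 1≤x 1≤y = begin
    1ℚ      ≤⟨ 1≤y ⟩
    y       ≡⟨ *-identityˡ y ⟨
    1ℚ * y  ≤⟨ *-monoʳ-≤-nonNeg y {{1≤⇒nonNegative 1≤y}} 1≤x ⟩
    x * y   ∎
    where open ≤-Reasoning

  1≤-^ℚ-closed : ∀ {x} k → 1ℚ ≤ x → 1ℚ ≤ x ^ℚ k
  1≤-^ℚ-closed zero    _   = ≤-refl
  1≤-^ℚ-closed (suc k) 1≤x = 1≤-*-closed 1≤x (1≤-^ℚ-closed k 1≤x)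

  ^ᶻ-[1+]-≤ : ∀ {x y} k → 1ℚ ≤ x → 1ℚ ≤ x ^ℚ suc k * y → x ^ᶻ -[1+ k ] ≤ y
  ^ᶻ-[1+]-≤ {x} {y} k 1≤x 1≤xᵏ⁺¹y with x ^ℚ suc k ≟ 0ℚ
  ... | yes xᵏ⁺¹≡0 = ⊥-elim (<-irrefl refl (<-≤-trans (toWitness {a? = 0ℚ <? 1ℚ} _) (subst (1ℚ ≤_) xᵏ⁺¹≡0 (1≤-^ℚ-closed (suc k) 1≤x))))
  ... | no xᵏ⁺¹≢0 = *-cancelˡ-≤-pos X {{1≤⇒positive (1≤-^ℚ-closed (suc k) 1≤x)}}
    (subst (_≤ X * y) (sym (*-inverseʳ X {{≢-nonZero xᵏ⁺¹≢0}})) 1≤xᵏ⁺¹y)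
    where
    X = x ^ℚ suc k

  9≤⇒1≤n^[k+1]·⅓·⅔^[k+2] : ∀ {n} k → + 9 / 1 ≤ n → 1ℚ ≤ n ^ℚ suc k * (+ 1 / 3 * (+ 2 / 3) ^ℚ suc (suc k))
  9≤⇒1≤n^[k+1]·⅓·⅔^[k+2] {n} zero 9≤n = begin
    1ℚ                ≤⟨ toWitness {a? = 1ℚ ≤? + 9 / 1 * c} _ ⟩
    + 9 / 1 * c       ≤⟨ *-monoʳ-≤-nonNeg c 9≤n ⟩
    n * c             ≡⟨ cong (_* c) (*-identityʳ n) ⟨
    n * 1ℚ * c        ∎
    where
    open ≤-Reasoning
    c = + 1 / 3 * (+ 2 / 3) ^ℚ 2
  9≤⇒1≤n^[k+1]·⅓·⅔^[k+2] {n} (suc k) 9≤n =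
    subst (1ℚ ≤_) (regroup n (n ^ℚ suc k) (+ 1 / 3) (+ 2 / 3) ((+ 2 / 3) ^ℚ suc (suc k)))
      (1≤-*-closed 1≤n·⅔ (9≤⇒1≤n^[k+1]·⅓·⅔^[k+2] k 9≤n))
    where
    open +-*-Solver
    1≤n·⅔ : 1ℚ ≤ n * (+ 2 / 3)
    1≤n·⅔ = ≤-trans (toWitness {a? = 1ℚ ≤? + 9 / 1 * (+ 2 / 3)} _) (*-monoʳ-≤-nonNeg (+ 2 / 3) 9≤n)
    regroup : ∀ n A t c B → n * c * (A * (t * B)) ≡ n * A * (t * (c * B))
    regroup = solve 5 (λ n A t c B → n :* c :* (A :* (t :* B)) := n :* A :* (t :* (c :* B))) refl

  9≤∧3≤⇒bound : ∀ {N r} → 9 ℕ.≤ N → 3 ℕ.≤ r →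
    (+ N / 1) ^ᶻ (+ 2 - + r) ≤ + 1 / 3 * (+ 2 / 3) ^ᶻ (+ r - + 1)
  9≤∧3≤⇒bound {N} {suc (suc (suc k))} 9≤N (ℕ.s≤s (ℕ.s≤s (ℕ.s≤s _))) =
    ^ᶻ-[1+]-≤ k (≤-trans (toWitness {a? = 1ℚ ≤? + 9 / 1} _) 9≤n) (9≤⇒1≤n^[k+1]·⅓·⅔^[k+2] k 9≤n)
    where
    9≤n = /1-mono-≤ 9≤N

open OddPerfectNumbers using (oddPerfect⇒9≤; oddPerfect⇒3≤ω)
open RationalPowers using (9≤∧3≤⇒bound)

open import Data.Nat using (ℕ)
open import Data.Integer using (+_; _-_)
open import Data.Rational using (_≤_; _*_; _/_)

corollary4p2p3 : (N : ℕ) → OddPerfect N →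
    ((+ N / 1) ^ᶻ (+ 2 - + ω N)) ≤ ((+ 1 / 3) * ((+ 2 / 3) ^ᶻ (+ ω N - + 1)))
corollary4p2p3 N op = 9≤∧3≤⇒bound (oddPerfect⇒9≤ op) (oddPerfect⇒3≤ω op)
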